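{- There is a universal constant $C$ such that for any prime $p$, any positive integer $k$, and any distinct $g_0,g_1\in\mathbb{Z}_p$, there is a $k$-party, one-round, deterministic protocol for the Sum-Distinguish problem over $\mathbb{Z}_p$ relative to $g_0,g_1$ with (total) communication complexity at most $k\log k + C\cdot k$.
   Context: Model: parties $P_1,\dots,P_k$ each receive an input $x_i\in\mathbb{Z}_p$. In a one-round protocol, each party $P_i$ sends a single message, depending only on $x_i$ (and the protocol), to a coordinator distinct from the parties; there is no other communication, and the coordinator then outputs a bit computed from the received messages. The communication complexity is the total number of bits sent by all parties (in the worst case). A deterministic protocol solves the $k$-party Sum-Distinguish problem relative to distinct $g_0,g_1$ if, on every input with $\sum_i x_i \equiv g_1 \pmod p$, the coordinator outputs $1$, and on every input with $\sum_i x_i\equiv g_0\pmod p$, it outputs $0$ (other inputs are unconstrained). Logarithms are base 2. -}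

module Defs where

open import Data.Nat using (ℕ; zero; suc; _+_; NonZero; _%_)
open import Data.Fin using (Fin; toℕ)
import Data.Fin as F
open import Data.Bool using (Bool; true; false)
open import Data.Vec using (Vec)
open import Relation.Binary.PropositionalEquality using (_≡_)
open import Data.Product using (_×_)

sumFin : ∀ {k} → (Fin k → ℕ) → ℕ
sumFin {zero}  f = 0
sumFin {suc k} f = f F.zero + sumFin (λ i → f (F.suc i))

record Protocol (p k : ℕ) : Set where
  field
    len   : Fin k → ℕ
    msg   : (i : Fin k) → Fin p → Vec Bool (len i)
    out   : ((i : Fin k) → Vec Bool (len i)) → Bool

open Protocol public

cost : ∀ {p k} → Protocol p k → ℕ
cost P = sumFin (len P)

run : ∀ {p k} → Protocol p k → (Fin k → Fin p) → Bool
run P x = out P (λ i → msg P i (x i))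

sumMod : ∀ {p k} .{{_ : NonZero p}} → (Fin k → Fin p) → ℕ
sumMod {p} x = sumFin (λ i → toℕ (x i)) % p

SolvesSumDistinguish : ∀ {p k} .{{_ : NonZero p}} → Protocol p k → Fin p → Fin p → Set
SolvesSumDistinguish P g₀ g₁ =
  (∀ x → sumMod x ≡ toℕ g₁ → run P x ≡ true) × (∀ x → sumMod x ≡ toℕ g₀ → run P x ≡ false)

-- Multiply every input by a unit a of ℤ_p chosen so that a·g₁ ≡ a·g₀ + ⌊p/2⌋, and let each party
-- send the L-bit quantization ⌊(a·x mod p)·2^L / p⌋ of its scaled input, where 4k ≤ 2^L ≤ 8k.
-- The messages pin the integer sum of the k residues down to a window of width k·p/2^L ≤ p/4,
-- whereas inputs summing to g₀ and to g₁ have residue sums about p/2 apart modulo p. Hence no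
-- message vector comes from both kinds of input, and the coordinator may answer by searching for
-- an input with sum g₁ that produces the received messages. The cost is k·L ≤ k log k + 3k bits.

module Submission where

open import Defs
open import Data.Nat using (ℕ; NonZero; _+_; _*_; _^_; _≤_)
open import Data.Nat.Primality using (Prime)
open import Data.Fin using (Fin)
open import Data.Product using (Σ; ∃; ∃-syntax; _×_)
open import Relation.Binary.PropositionalEquality using (_≢_)

open import Data.Bool using (Bool)
import Data.Bool as Bool
open import Data.Empty using (⊥)
import Data.Fin as F
open import Data.Fin using (toℕ)
open import Data.Fin.Properties
  using (toℕ<n; toℕ-injective; toℕ-fromℕ<; 2↔Bool; any?; all?; funToFin-finToFin; finToFun-funToFin)
open import Data.Nat
open import Data.Nat.Coprimality using (prime⇒coprime; coprime-Bézout)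
open import Data.Nat.Divisibility
open import Data.Nat.DivMod
open import Data.Nat.GCD using (module Bézout)
open import Data.Nat.Primality using (prime⇒nonTrivial)
open import Data.Nat.Properties
open import Algebra.Properties.CommutativeSemigroup +-commutativeSemigroup using (interchange)
open import Algebra.Properties.CommutativeSemigroup *-commutativeSemigroup
  using () renaming (interchange to *-interchange)
open import Data.Nat.Tactic.RingSolver using (solve-∀)
open import Data.Product using (_,_; proj₁; proj₂)
open import Data.Sum using ([_,_]′)
open import Data.Vec using (Vec; tabulate; lookup)
open import Data.Vec.Properties using (lookup∘tabulate; ≡-dec)
open import Function using (_∘_; Inverse)
open import Relation.Binary.Definitions using (tri<; tri≈; tri>)
open import Relation.Binary.PropositionalEquality
open import Relation.Nullary using (contradiction)
open import Relation.Nullary.Decidable using (Dec; yes; no; does; map′; _×-dec_; dec-true; dec-false)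

sumFin-cong : ∀ {k} {f g : Fin k → ℕ} → f ≗ g → sumFin f ≡ sumFin g
sumFin-cong {zero}  f≗g = refl
sumFin-cong {suc k} f≗g = cong₂ _+_ (f≗g F.zero) (sumFin-cong (f≗g ∘ F.suc))

sumFin-mono : ∀ {k} {f g : Fin k → ℕ} → (∀ i → f i ≤ g i) → sumFin f ≤ sumFin g
sumFin-mono {zero}  f≤g = z≤n
sumFin-mono {suc k} f≤g = +-mono-≤ (f≤g F.zero) (sumFin-mono (f≤g ∘ F.suc))

sumFin-mono-< : ∀ {k} .{{_ : NonZero k}} {f g : Fin k → ℕ} → (∀ i → f i < g i) → sumFin f < sumFin g
sumFin-mono-< {suc k} f<g = +-mono-<-≤ (f<g F.zero) (sumFin-mono (<⇒≤ ∘ f<g ∘ F.suc))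

sumFin-+ : ∀ {k} (f g : Fin k → ℕ) → sumFin (λ i → f i + g i) ≡ sumFin f + sumFin g
sumFin-+ {zero}  f g = refl
sumFin-+ {suc k} f g = trans (cong (f F.zero + g F.zero +_) (sumFin-+ (f ∘ F.suc) (g ∘ F.suc)))
                             (interchange (f F.zero) (g F.zero) _ _)

sumFin-*ʳ : ∀ {k} (f : Fin k → ℕ) c → sumFin (λ i → f i * c) ≡ sumFin f * c
sumFin-*ʳ {zero}  f c = refl
sumFin-*ʳ {suc k} f c = trans (cong (f F.zero * c +_) (sumFin-*ʳ (f ∘ F.suc) c))
                              (sym (*-distribʳ-+ c (f F.zero) _))

sumFin-*ˡ : ∀ {k} c (f : Fin k → ℕ) → sumFin (λ i → c * f i) ≡ c * sumFin f
sumFin-*ˡ c f = trans (sumFin-cong (λ i → *-comm c (f i))) (trans (sumFin-*ʳ f c) (*-comm _ c))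

sumFin-const : ∀ k c → sumFin {k} (λ _ → c) ≡ k * c
sumFin-const zero    c = refl
sumFin-const (suc k) c = cong (c +_) (sumFin-const k c)

sumFin-% : ∀ {k} (f : Fin k → ℕ) p .{{_ : NonZero p}} → sumFin (λ i → f i % p) % p ≡ sumFin f % p
sumFin-% {zero}  f p = refl
sumFin-% {suc k} f p = begin
  (f F.zero % p + sumFin (λ i → f (F.suc i) % p)) % p
    ≡⟨ %-distribˡ-+ (f F.zero % p) _ p ⟩
  (f F.zero % p % p + sumFin (λ i → f (F.suc i) % p) % p) % p
    ≡⟨ cong₂ (λ u v → (u + v) % p) (m%n%n≡m%n (f F.zero) p) (sumFin-% (f ∘ F.suc) p) ⟩
  (f F.zero % p + sumFin (f ∘ F.suc) % p) % p
    ≡⟨ %-distribˡ-+ (f F.zero) _ p ⟨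
  (f F.zero + sumFin (f ∘ F.suc)) % p ∎
  where open ≡-Reasoning

m<m/n*n+n : ∀ m n .{{_ : NonZero n}} → m < m / n * n + n
m<m/n*n+n m n = begin-strict
  m                 ≡⟨ m≡m%n+[m/n]*n m n ⟩
  m % n + m / n * n <⟨ +-monoˡ-< (m / n * n) (m%n<n m n) ⟩
  n + m / n * n     ≡⟨ +-comm n (m / n * n) ⟩
  m / n * n + n     ∎
  where open ≤-Reasoning

%-cong-+ : ∀ {m m′ n n′ p} .{{_ : NonZero p}} → m % p ≡ m′ % p → n % p ≡ n′ % p →
           (m + n) % p ≡ (m′ + n′) % p
%-cong-+ {m} {m′} {n} {n′} {p} m≡m′ n≡n′ = begin
  (m + n) % p           ≡⟨ %-distribˡ-+ m n p ⟩
  (m % p + n % p) % p   ≡⟨ cong₂ (λ r s → (r + s) % p) m≡m′ n≡n′ ⟩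
  (m′ % p + n′ % p) % p ≡⟨ %-distribˡ-+ m′ n′ p ⟨
  (m′ + n′) % p         ∎
  where open ≡-Reasoning

%-shift⇒∣ : ∀ m d p .{{_ : NonZero p}} → (m + d) % p ≡ m % p → p ∣ d
%-shift⇒∣ m d p eq = ∣m+n∣m⇒∣n (divides ((m + d) / p) (+-cancelˡ-≡ (m % p) _ _ (begin
  m % p + (m / p * p + d)       ≡⟨ +-assoc (m % p) (m / p * p) d ⟨
  m % p + m / p * p + d         ≡⟨ cong (_+ d) (m≡m%n+[m/n]*n m p) ⟨
  m + d                         ≡⟨ m≡m%n+[m/n]*n (m + d) p ⟩
  (m + d) % p + (m + d) / p * p ≡⟨ cong (_+ (m + d) / p * p) eq ⟩
  m % p + (m + d) / p * p       ∎))) (n∣m*n (m / p))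
  where open ≡-Reasoning

small-shift≢large-shift : ∀ {m e s p} .{{_ : NonZero p}} → 4 * e < p → p ≤ 4 * s → s < p →
                          (m + e) % p ≢ (m + s) % p
small-shift≢large-shift {m} {e} {s} {p} 4e<p p≤4s s<p eq =
  >⇒∤ {{>-nonZero (m<n⇒0<n∸m e<s)}} (≤-<-trans (m∸n≤m s e) s<p) (%-shift⇒∣ (m + e) (s ∸ e) p shifted)
  where
  e<s : e < s
  e<s = *-cancelˡ-< 4 e s (<-≤-trans 4e<p p≤4s)
  shifted : (m + e + (s ∸ e)) % p ≡ (m + e) % p
  shifted = trans (cong (_% p) (trans (+-assoc m e (s ∸ e)) (cong (m +_) (m+[n∸m]≡n (<⇒≤ e<s)))))
                  (sym eq)

n≤4*⌊n/2⌋ : ∀ {n} → 2 ≤ n → n ≤ 4 * ⌊ n /2⌋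
n≤4*⌊n/2⌋ {1} (s≤s ())
n≤4*⌊n/2⌋ {2} _ = s≤s (s≤s z≤n)
n≤4*⌊n/2⌋ {3} _ = s≤s (s≤s (s≤s z≤n))
n≤4*⌊n/2⌋ {suc (suc n@(suc (suc _)))} _ = begin
  2 + n               ≤⟨ +-monoʳ-≤ 2 (n≤4*⌊n/2⌋ {n} (s≤s (s≤s z≤n))) ⟩
  2 + 4 * ⌊ n /2⌋     ≤⟨ +-monoˡ-≤ (4 * ⌊ n /2⌋) {2} {4} (s≤s (s≤s z≤n)) ⟩
  4 + 4 * ⌊ n /2⌋     ≡⟨ *-suc 4 ⌊ n /2⌋ ⟨
  4 * ⌊ 2 + n /2⌋     ∎
  where open ≤-Reasoning

InWindow : (M w A Y : ℕ) → Set
InWindow M w A Y = A ≤ Y * M × Y * M < A + w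

window-gap : ∀ {k M p A Y Y′} → 4 * k ≤ M → InWindow M (k * p) A Y → InWindow M (k * p) A Y′ →
             Y ≤ Y′ → 4 * (Y′ ∸ Y) < p
window-gap {k} {M} {p} {A} {Y} {Y′} 4k≤M (A≤Y , _) (_ , Y′<) Y≤Y′ =
  *-cancelˡ-< k (4 * e) p (begin-strict
  k * (4 * e) ≡⟨ *-assoc k 4 e ⟨
  k * 4 * e   ≡⟨ cong (_* e) (*-comm k 4) ⟩
  4 * k * e   ≤⟨ *-monoˡ-≤ e 4k≤M ⟩
  M * e       ≡⟨ *-comm M e ⟩
  e * M       <⟨ +-cancelˡ-< (Y * M) (e * M) (k * p) eM< ⟩
  k * p       ∎)
  where
  open ≤-Reasoning
  e = Y′ ∸ Y
  eM< : Y * M + e * M < Y * M + k * p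
  eM< = begin-strict
    Y * M + e * M ≡⟨ *-distribʳ-+ M Y e ⟨
    (Y + e) * M   ≡⟨ cong (_* M) (m+[n∸m]≡n Y≤Y′) ⟩
    Y′ * M        <⟨ Y′< ⟩
    A + k * p     ≤⟨ +-monoˡ-≤ (k * p) A≤Y ⟩
    Y * M + k * p ∎

windowed-residues-not-antipodal : ∀ {k M p A Y Y′ c} .{{_ : NonZero p}} → 2 ≤ p → 4 * k ≤ M →
  InWindow M (k * p) A Y → InWindow M (k * p) A Y′ → Y % p ≡ c % p → Y′ % p ≢ (c + ⌊ p /2⌋) % p
windowed-residues-not-antipodal {k} {M} {p} {A} {Y} {Y′} {c} 2≤p 4k≤M wY wY′ Y≡c Y′≡c+h =
  [ Y′-above , Y′-below ]′ (≤-total Y Y′)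
  where
  open ≡-Reasoning
  halves<n : ∀ {n} → 2 ≤ n → ⌊ n /2⌋ < n × ⌈ n /2⌉ < n
  halves<n {suc (suc n)} (s≤s (s≤s _)) = ⌊n/2⌋<n (suc n) , ⌈n/2⌉<n n
  Y′-above : Y ≤ Y′ → ⊥
  Y′-above Y≤Y′ = small-shift≢large-shift (window-gap {k} 4k≤M wY wY′ Y≤Y′)
                    (n≤4*⌊n/2⌋ 2≤p) (proj₁ (halves<n 2≤p)) (begin
    (Y + (Y′ ∸ Y)) % p ≡⟨ cong (_% p) (m+[n∸m]≡n Y≤Y′) ⟩
    Y′ % p             ≡⟨ Y′≡c+h ⟩
    (c + ⌊ p /2⌋) % p  ≡⟨ %-cong-+ Y≡c refl ⟨
    (Y + ⌊ p /2⌋) % p  ∎)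
  Y′-below : Y′ ≤ Y → ⊥
  Y′-below Y′≤Y = small-shift≢large-shift (window-gap {k} 4k≤M wY′ wY Y′≤Y)
                    p≤4⌈p/2⌉ (proj₂ (halves<n 2≤p)) (begin
    (Y′ + (Y ∸ Y′)) % p           ≡⟨ cong (_% p) (m+[n∸m]≡n Y′≤Y) ⟩
    Y % p                         ≡⟨ Y≡c ⟩
    c % p                         ≡⟨ [m+n]%n≡m%n c p ⟨
    (c + p) % p                   ≡⟨ cong (λ t → (c + t) % p) (⌊n/2⌋+⌈n/2⌉≡n p) ⟨
    (c + (⌊ p /2⌋ + ⌈ p /2⌉)) % p ≡⟨ cong (_% p) (+-assoc c ⌊ p /2⌋ ⌈ p /2⌉) ⟨
    (c + ⌊ p /2⌋ + ⌈ p /2⌉) % p   ≡⟨ %-cong-+ Y′≡c+h refl ⟨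
    (Y′ + ⌈ p /2⌉) % p            ∎)
    where
    p≤4⌈p/2⌉ : p ≤ 4 * ⌈ p /2⌉
    p≤4⌈p/2⌉ = ≤-trans (n≤4*⌊n/2⌋ 2≤p) (*-monoʳ-≤ 4 (⌊n/2⌋≤⌈n/2⌉ p))

prime⇒congruence-solvable : ∀ {p d} .{{_ : NonZero d}} .{{_ : NonZero p}} → Prime p → d < p →
                            ∀ t → ∃[ a ] a * d % p ≡ t % p
prime⇒congruence-solvable {p} {d} p-prime d<p t with coprime-Bézout (prime⇒coprime p-prime d<p)
... | Bézout.-+ x y 1+xp≡yd = y * t , (begin
  y * t * d % p       ≡⟨ cong (_% p) (regroup y t d) ⟩
  t * (y * d) % p     ≡⟨ cong (λ u → t * u % p) 1+xp≡yd ⟨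
  t * (1 + x * p) % p ≡⟨ cong (_% p) (expand t x p) ⟩
  (t + t * x * p) % p ≡⟨ [m+kn]%n≡m%n t (t * x) p ⟩
  t % p               ∎)
  where
  open ≡-Reasoning
  regroup : ∀ y t d → y * t * d ≡ t * (y * d)
  regroup = solve-∀
  expand : ∀ t x p → t * (1 + x * p) ≡ t + t * x * p
  expand = solve-∀
-- Here y·d ≡ -1 (mod p), so y·(p - 1) inverts d.
... | Bézout.+- x y 1+yd≡xp = y * q * t , (begin
  y * q * t * d % p               ≡⟨ [m+kn]%n≡m%n (y * q * t * d) t p ⟨
  (y * q * t * d + t * p) % p     ≡⟨ cong (λ u → (y * q * t * d + t * u) % p) (suc-pred p) ⟨
  (y * q * t * d + t * suc q) % p ≡⟨ cong (_% p) (regroup y q t d) ⟩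
  (t + q * t * (1 + y * d)) % p   ≡⟨ cong (λ u → (t + q * t * u) % p) 1+yd≡xp ⟩
  (t + q * t * (x * p)) % p       ≡⟨ cong (λ u → (t + u) % p) (*-assoc (q * t) x p) ⟨
  (t + q * t * x * p) % p         ≡⟨ [m+kn]%n≡m%n t (q * t * x) p ⟩
  t % p                           ∎)
  where
  open ≡-Reasoning
  q = pred p
  regroup : ∀ y q t d → y * q * t * d + t * suc q ≡ t + q * t * (1 + y * d)
  regroup = solve-∀

prime⇒shifting-multiplier : ∀ {p n₀ n₁} .{{_ : NonZero p}} → Prime p → n₀ < p → n₁ < p → n₀ ≢ n₁ →
                            ∀ s → s ≤ p → ∃[ a ] a * n₁ % p ≡ (a * n₀ + s) % p
prime⇒shifting-multiplier {p} {n₀} {n₁} p-prime n₀<p n₁<p n₀≢n₁ s s≤p with <-cmp n₀ n₁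
... | tri≈ _ n₀≡n₁ _ = contradiction n₀≡n₁ n₀≢n₁
... | tri< n₀<n₁ _ _ = up (prime⇒congruence-solvable {{>-nonZero (m<n⇒0<n∸m n₀<n₁)}}
                                p-prime (≤-<-trans (m∸n≤m n₁ n₀) n₁<p) s)
  where
  open ≡-Reasoning
  up : ∃[ a ] a * (n₁ ∸ n₀) % p ≡ s % p → ∃[ a ] a * n₁ % p ≡ (a * n₀ + s) % p
  up (a , ad≡s) = a , (begin
    a * n₁ % p                   ≡⟨ cong (λ n → a * n % p) (m+[n∸m]≡n (<⇒≤ n₀<n₁)) ⟨
    a * (n₀ + (n₁ ∸ n₀)) % p     ≡⟨ cong (_% p) (*-distribˡ-+ a n₀ (n₁ ∸ n₀)) ⟩
    (a * n₀ + a * (n₁ ∸ n₀)) % p ≡⟨ %-cong-+ refl ad≡s ⟩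
    (a * n₀ + s) % p             ∎)
... | tri> _ _ n₁<n₀ = down (prime⇒congruence-solvable {{>-nonZero (m<n⇒0<n∸m n₁<n₀)}}
                                  p-prime (≤-<-trans (m∸n≤m n₀ n₁) n₀<p) (p ∸ s))
  where
  open ≡-Reasoning
  down : ∃[ a ] a * (n₀ ∸ n₁) % p ≡ (p ∸ s) % p → ∃[ a ] a * n₁ % p ≡ (a * n₀ + s) % p
  down (a , ad≡p∸s) = a , (begin
    a * n₁ % p                         ≡⟨ [m+n]%n≡m%n (a * n₁) p ⟨
    (a * n₁ + p) % p                   ≡⟨ cong (λ u → (a * n₁ + u) % p) (m∸n+n≡m s≤p) ⟨
    (a * n₁ + (p ∸ s + s)) % p         ≡⟨ cong (_% p) (+-assoc (a * n₁) (p ∸ s) s) ⟨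
    (a * n₁ + (p ∸ s) + s) % p         ≡⟨ %-cong-+ {a * n₁ + (p ∸ s)} (%-cong-+ refl (sym ad≡p∸s))
                                                      refl ⟩
    (a * n₁ + a * (n₀ ∸ n₁) + s) % p   ≡⟨ cong (λ u → (u + s) % p) (*-distribˡ-+ a n₁ (n₀ ∸ n₁)) ⟨
    (a * (n₁ + (n₀ ∸ n₁)) + s) % p     ≡⟨ cong (λ n → (a * n + s) % p) (m+[n∸m]≡n (<⇒≤ n₁<n₀)) ⟩
    (a * n₀ + s) % p                   ∎)

power-of-two-between : ∀ n .{{_ : NonZero n}} → ∃[ L ] (n ≤ 2 ^ L × 2 ^ L ≤ 2 * n)
power-of-two-between 1 = 0 , ≤-refl , s≤s z≤n
power-of-two-between (suc (suc m)) with power-of-two-between (suc m)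
... | L , lo , hi with 2 + m ≤? 2 ^ L
...   | yes fits = L , fits , ≤-trans hi (*-monoʳ-≤ 2 (n≤1+n (suc m)))
...   | no ¬fits = suc L , ≤-trans 2+m≤2*[1+m] (*-monoʳ-≤ 2 lo) , *-monoʳ-≤ 2 (<⇒≤ (≰⇒> ¬fits))
  where
  2+m≤2*[1+m] : 2 + m ≤ 2 * (1 + m)
  2+m≤2*[1+m] = s≤s (≤-trans (m≤n+m (suc m) m) (+-monoʳ-≤ m (s≤s (m≤m+n m 0))))

^-distribʳ-* : ∀ m n k → (m * n) ^ k ≡ m ^ k * n ^ k
^-distribʳ-* m n zero    = refl
^-distribʳ-* m n (suc k) = trans (cong (m * n *_) (^-distribʳ-* m n k)) (*-interchange m n _ _)

2^[k*L]≤k^k*2^[3k] : ∀ k L → 2 ^ L ≤ 8 * k → 2 ^ (k * L) ≤ k ^ k * 2 ^ (3 * k)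
2^[k*L]≤k^k*2^[3k] k L 2^L≤8k = begin
  2 ^ (k * L)         ≡⟨ cong (2 ^_) (*-comm k L) ⟩
  2 ^ (L * k)         ≡⟨ ^-*-assoc 2 L k ⟨
  (2 ^ L) ^ k         ≤⟨ ^-monoˡ-≤ k 2^L≤8k ⟩
  (2 ^ 3 * k) ^ k     ≡⟨ ^-distribʳ-* (2 ^ 3) k k ⟩
  (2 ^ 3) ^ k * k ^ k ≡⟨ cong (_* k ^ k) (^-*-assoc 2 3 k) ⟩
  2 ^ (3 * k) * k ^ k ≡⟨ *-comm (2 ^ (3 * k)) (k ^ k) ⟩
  k ^ k * 2 ^ (3 * k) ∎
  where open ≤-Reasoning

toBits : ∀ L → Fin (2 ^ L) → Vec Bool L
toBits L i = tabulate (Inverse.to 2↔Bool ∘ F.finToFun i)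

fromBits : ∀ {L} → Vec Bool L → Fin (2 ^ L)
fromBits v = F.funToFin (Inverse.from 2↔Bool ∘ lookup v)

funToFin-cong : ∀ {m n} {f g : Fin m → Fin n} → f ≗ g → F.funToFin f ≡ F.funToFin g
funToFin-cong {zero}  f≗g = refl
funToFin-cong {suc m} f≗g = cong₂ F.combine (f≗g F.zero) (funToFin-cong (f≗g ∘ F.suc))

fromBits∘toBits : ∀ L (i : Fin (2 ^ L)) → fromBits (toBits L i) ≡ i
fromBits∘toBits L i = trans (funToFin-cong {L} bitwise) (funToFin-finToFin {L} i)
  where
  bitwise : Inverse.from 2↔Bool ∘ lookup (toBits L i) ≗ F.finToFun i
  bitwise j = trans (cong (Inverse.from 2↔Bool) (lookup∘tabulate _ j))
                    (Inverse.strictlyInverseʳ 2↔Bool _)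

encode : ∀ L {n} → n < 2 ^ L → Vec Bool L
encode L n<2^L = toBits L (F.fromℕ< n<2^L)

encode-injective : ∀ L {m n} (m< : m < 2 ^ L) (n< : n < 2 ^ L) → encode L m< ≡ encode L n< → m ≡ n
encode-injective L {m} {n} m< n< eq = begin
  m                            ≡⟨ toℕ-fromℕ< m< ⟨
  toℕ (F.fromℕ< m<)            ≡⟨ cong toℕ (fromBits∘toBits L (F.fromℕ< m<)) ⟨
  toℕ (fromBits (encode L m<)) ≡⟨ cong (toℕ ∘ fromBits {L}) eq ⟩
  toℕ (fromBits (encode L n<)) ≡⟨ cong toℕ (fromBits∘toBits L (F.fromℕ< n<)) ⟩
  toℕ (F.fromℕ< n<)            ≡⟨ toℕ-fromℕ< n< ⟩
  n                            ∎
  where open ≡-Reasoning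

any-input? : ∀ {p k ℓ} {P : (Fin k → Fin p) → Set ℓ} → (∀ {x y} → x ≗ y → P x → P y) →
             (∀ x → Dec (P x)) → Dec (∃ P)
any-input? resp P? = map′ (λ (j , Pj) → F.finToFun j , Pj)
                          (λ (x , Px) → F.funToFin x , resp (sym ∘ finToFun-funToFin x) Px)
                          (any? (P? ∘ F.finToFun))

module _ {p k} .{{_ : NonZero p}} {len : Fin k → ℕ} (msg : (i : Fin k) → Fin p → Vec Bool (len i)) where

  Separates : Fin p → Fin p → Set
  Separates g₀ g₁ = ∀ x x′ → (∀ i → msg i (x i) ≡ msg i (x′ i)) → sumMod x ≡ toℕ g₀ → sumMod x′ ≢ toℕ g₁

  module _ (g₁ : Fin p) where

    Explains : ((i : Fin k) → Vec Bool (len i)) → (Fin k → Fin p) → Set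
    Explains v x = (∀ i → msg i (x i) ≡ v i) × sumMod x ≡ toℕ g₁

    explains? : ∀ v x → Dec (Explains v x)
    explains? v x = all? (λ i → ≡-dec Bool._≟_ (msg i (x i)) (v i)) ×-dec (sumMod x ≟ toℕ g₁)

    Explains-resp-≗ : ∀ v {x y} → x ≗ y → Explains v x → Explains v y
    Explains-resp-≗ v x≗y (sends-v , sum≡g₁) =
      (λ i → subst (λ z → msg i z ≡ v i) (x≗y i) (sends-v i)) ,
      trans (cong (_% p) (sumFin-cong (sym ∘ cong toℕ ∘ x≗y))) sum≡g₁

    explained? : ∀ v → Dec (∃ (Explains v))
    explained? v = any-input? (Explains-resp-≗ v) (explains? v)

    decodingProtocol : Protocol p k
    decodingProtocol = record { len = len ; msg = msg ; out = does ∘ explained? }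

    decodingProtocol-solves : ∀ {g₀} → Separates g₀ g₁ → SolvesSumDistinguish decodingProtocol g₀ g₁
    decodingProtocol-solves separates =
      (λ x sum≡g₁ → dec-true (explained? _) (x , (λ _ → refl) , sum≡g₁)) ,
      (λ x sum≡g₀ → dec-false (explained? _)
        λ (x′ , sends , sum′≡g₁) → separates x x′ (sym ∘ sends) sum≡g₀ sum′≡g₁)

module Quantization (p L a : ℕ) .{{_ : NonZero p}} where

  M : ℕ
  M = 2 ^ L

  instance
    M≢0 : NonZero M
    M≢0 = m^n≢0 2 L

  residue : Fin p → ℕ
  residue z = a * toℕ z % p

  level : Fin p → ℕ
  level z = residue z * M / p

  level<M : ∀ z → level z < M
  level<M z = m<n*o⇒m/o<n (begin-strict
    residue z * M <⟨ *-monoˡ-< M (m%n<n (a * toℕ z) p) ⟩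
    p * M         ≡⟨ *-comm p M ⟩
    M * p         ∎)
    where open ≤-Reasoning

  message : Fin p → Vec Bool L
  message z = encode L (level<M z)

  residue-sum-window : ∀ {k} .{{_ : NonZero k}} (x : Fin k → Fin p) →
                       InWindow M (k * p) (sumFin (λ i → level (x i) * p)) (sumFin (residue ∘ x))
  residue-sum-window {k} x = lower , upper
    where
    open ≤-Reasoning
    lower : sumFin (λ i → level (x i) * p) ≤ sumFin (residue ∘ x) * M
    lower = begin
      sumFin (λ i → level (x i) * p)   ≤⟨ sumFin-mono (λ i → m/n*n≤m (residue (x i) * M) p) ⟩
      sumFin (λ i → residue (x i) * M) ≡⟨ sumFin-*ʳ (residue ∘ x) M ⟩
      sumFin (residue ∘ x) * M         ∎
    upper : sumFin (residue ∘ x) * M < sumFin (λ i → level (x i) * p) + k * p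
    upper = begin-strict
      sumFin (residue ∘ x) * M
        ≡⟨ sumFin-*ʳ (residue ∘ x) M ⟨
      sumFin (λ i → residue (x i) * M)
        <⟨ sumFin-mono-< (λ i → m<m/n*n+n (residue (x i) * M) p) ⟩
      sumFin (λ i → level (x i) * p + p)
        ≡⟨ sumFin-+ (λ i → level (x i) * p) (λ _ → p) ⟩
      sumFin (λ i → level (x i) * p) + sumFin {k} (λ _ → p)
        ≡⟨ cong (sumFin (λ i → level (x i) * p) +_) (sumFin-const k p) ⟩
      sumFin (λ i → level (x i) * p) + k * p
        ∎

  residue-sum-mod : ∀ {k} (x : Fin k → Fin p) → sumFin (residue ∘ x) % p ≡ a * sumMod x % p
  residue-sum-mod x = begin
    sumFin (residue ∘ x) % p         ≡⟨ sumFin-% (λ i → a * toℕ (x i)) p ⟩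
    sumFin (λ i → a * toℕ (x i)) % p ≡⟨ cong (_% p) (sumFin-*ˡ a (toℕ ∘ x)) ⟩
    a * S % p                        ≡⟨ %-distribˡ-* a S p ⟩
    a % p * (S % p) % p              ≡⟨ cong (λ s → a % p * s % p) (m%n%n≡m%n S p) ⟨
    a % p * (S % p % p) % p          ≡⟨ %-distribˡ-* a (S % p) p ⟨
    a * (S % p) % p                  ∎
    where
    open ≡-Reasoning
    S = sumFin (toℕ ∘ x)

  quantization-separates : ∀ {k} .{{_ : NonZero k}} {g₀ g₁ : Fin p} → 2 ≤ p → 4 * k ≤ M →
                           a * toℕ g₁ % p ≡ (a * toℕ g₀ + ⌊ p /2⌋) % p →
                           Separates {k = k} (λ _ → message) g₀ g₁
  quantization-separates {k} {g₀} {g₁} 2≤p 4k≤M antipodal x x′ same-messages sum≡g₀ sum′≡g₁ =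
    windowed-residues-not-antipodal {k} 2≤p 4k≤M (residue-sum-window x) window′
      (trans (residue-sum-mod x) (cong (λ s → a * s % p) sum≡g₀))
      (trans (residue-sum-mod x′) (trans (cong (λ s → a * s % p) sum′≡g₁) antipodal))
    where
    same-levels : ∀ i → level (x′ i) * p ≡ level (x i) * p
    same-levels i = cong (_* p) (sym (encode-injective L (level<M _) (level<M _) (same-messages i)))
    window′ : InWindow M (k * p) (sumFin (λ i → level (x i) * p)) (sumFin (residue ∘ x′))
    window′ = subst (λ A → InWindow M (k * p) A (sumFin (residue ∘ x′))) (sumFin-cong same-levels)
                    (residue-sum-window x′)

  quantizedProtocol : ∀ {k} → Fin p → Protocol p k
  quantizedProtocol g₁ = decodingProtocol (λ _ → message) g₁

  quantizedProtocol-cost : ∀ {k} (g₁ : Fin p) → cost (quantizedProtocol {k} g₁) ≡ k * L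
  quantizedProtocol-cost {k} _ = sumFin-const k L

theorem12 : ∃[ C ] (∀ (p : ℕ) .{{_ : NonZero p}} → Prime p → ∀ (k : ℕ) → 1 ≤ k → (g₀ g₁ : Fin p) → g₀ ≢ g₁ →
              Σ (Protocol p k) (λ P → SolvesSumDistinguish P g₀ g₁ × 2 ^ cost P ≤ k ^ k * 2 ^ (C * k)))
theorem12 = 3 , protocol
  where
  protocol : ∀ (p : ℕ) .{{_ : NonZero p}} → Prime p → ∀ (k : ℕ) → 1 ≤ k → (g₀ g₁ : Fin p) → g₀ ≢ g₁ →
             Σ (Protocol p k) (λ P → SolvesSumDistinguish P g₀ g₁ × 2 ^ cost P ≤ k ^ k * 2 ^ (3 * k))
  protocol p p-prime k 1≤k g₀ g₁ g₀≢g₁ =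
    build (power-of-two-between (4 * k) {{m*n≢0 4 k}})
          (prime⇒shifting-multiplier p-prime (toℕ<n g₀) (toℕ<n g₁) (g₀≢g₁ ∘ toℕ-injective)
                                     ⌊ p /2⌋ (⌊n/2⌋≤n p))
    where
    instance
      k≢0 : NonZero k
      k≢0 = >-nonZero 1≤k
    build : ∃[ L ] (4 * k ≤ 2 ^ L × 2 ^ L ≤ 2 * (4 * k)) →
            ∃[ a ] a * toℕ g₁ % p ≡ (a * toℕ g₀ + ⌊ p /2⌋) % p →
            Σ (Protocol p k) (λ P → SolvesSumDistinguish P g₀ g₁ × 2 ^ cost P ≤ k ^ k * 2 ^ (3 * k))
    build (L , 4k≤2^L , 2^L≤2*4k) (a , antipodal) =
      quantizedProtocol g₁ ,
      decodingProtocol-solves (λ _ → message) g₁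
        (quantization-separates (nonTrivial⇒n>1 p {{prime⇒nonTrivial p-prime}}) 4k≤2^L antipodal) ,
      subst (λ c → 2 ^ c ≤ k ^ k * 2 ^ (3 * k)) (sym (quantizedProtocol-cost {k} g₁))
        (2^[k*L]≤k^k*2^[3k] k L (≤-trans 2^L≤2*4k (≤-reflexive (sym (*-assoc 2 4 k)))))
      where open Quantization p L a
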